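{- For all integers $r>k\geq 1$ there is $m_0$ such that for all integers $n\geq m\geq m_0$ we have $\mathrm{tc}_{r,k}(K_{n,m}) \geq \max\{r-k+1,\ r-k+\lfloor r/k\rfloor -1\}$.
   Context: For integers $r\geq k\geq 1$, an $(r,k)$-colouring of a graph $G$ is a function $\varphi:E(G)\to\binom{[r]}{k}$, assigning to each edge a set of exactly $k$ colours from $[r]=\{1,\dots,r\}$. A subgraph $H\subseteq G$ is monochromatic if there is a colour $i$ belonging to $\varphi(e)$ for every $e\in E(H)$. For an $(r,k)$-colouring $\varphi$ of $G$, $\mathrm{tc}(G,\varphi)$ is the minimum number of monochromatic trees (a single vertex counts as a tree) whose union covers $V(G)$. The tree cover number $\mathrm{tc}_{r,k}(G)$ is the minimum $m$ such that every $(r,k)$-colouring $\varphi$ of $E(G)$ satisfies $\mathrm{tc}(G,\varphi)\leq m$. $K_{n,m}$ is the complete bipartite graph with parts of sizes $n$ and $m$. -}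

module Defs where

open import Data.Nat using (ℕ; zero; suc; _≤_; _<_)
open import Data.Fin using (Fin; zero; suc; toℕ; inject₁)
open import Data.Fin.Subset using (Subset; ∣_∣; _∈_)
open import Data.Sum using (_⊎_; inj₁; inj₂)
open import Data.Product using (Σ; ∃; ∃-syntax; _×_; _,_)
open import Data.Empty using (⊥)
open import Relation.Binary.PropositionalEquality using (_≡_)
open import Function.Definitions using (Injective)

Vertex : ℕ → ℕ → Set
Vertex n m = Fin n ⊎ Fin m

record Colouring (r k n m : ℕ) : Set where
  field
    col  : Fin n → Fin m → Subset r
    size : ∀ a b → ∣ col a b ∣ ≡ k
open Colouring public

ColEdge : ∀ {r k n m} → Colouring r k n m → Fin r → Vertex n m → Vertex n m → Set
ColEdge φ c (inj₁ a) (inj₂ b) = c ∈ col φ a b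
ColEdge φ c (inj₂ b) (inj₁ a) = c ∈ col φ a b
ColEdge φ c (inj₁ _) (inj₁ _) = ⊥
ColEdge φ c (inj₂ _) (inj₂ _) = ⊥

-- A monochromatic tree (in colour c) in K_{n,m}, presented as a tree on
-- t+1 distinct vertices v_0,...,v_t built by successively attaching leaves:
-- vertex v_{j+1} is joined to an earlier vertex v_{parent j} (index ≤ j) by
-- an edge of K_{n,m} whose colour set contains c.  A single vertex is t = 0.
record MonoTree {r k n m : ℕ} (φ : Colouring r k n m) : Set where
  field
    colour   : Fin r
    size     : ℕ
    vertex   : Fin (suc size) → Vertex n m
    distinct : Injective _≡_ _≡_ vertex
    parent   : Fin size → Fin (suc size)
    parent≤  : ∀ j → toℕ (parent j) ≤ toℕ j
    edge     : ∀ j → ColEdge φ colour (vertex (suc j)) (vertex (parent j))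
open MonoTree public

TcAtMost : ∀ {r k n m} → Colouring r k n m → ℕ → Set
TcAtMost {n = n} {m = m} φ t =
  Σ ℕ λ s → s ≤ t × Σ (Fin s → MonoTree φ) λ T →
    ∀ (v : Vertex n m) → ∃[ i ] ∃[ j ] vertex (T i) j ≡ v

-- Split side A into s classes and let each vertex b of side B carry a family
-- C 1 … C s of colour sets; the edges at b are coloured by pairwise disjoint
-- k-sets β i with β i ∩ C i = ∅, which exist greedily when Σ (∣C i∣ - 1) + k < r.
-- By disjointness, a monochromatic tree with an edge stays inside one class.
-- If t < r - k + s trees cover the graph, then every class contains a tree
-- with an edge (single vertices cannot cover its t + 1 copies), so the colours
-- of the trees in class i form sets C i with Σ (∣C i∣ - 1) ≤ t - s < r - k; the
-- t + 1 vertices of B carrying this family meet no tree with an edge, a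
-- contradiction. The choice s = max (⌊r/k⌋ - 1) 1 gives the bound.
module Submission where

open import Defs
open import Data.Nat using (ℕ; zero; suc; _≤_; _<_; _+_; _*_; _∸_; _⊔_; _/_; _%_; _^_; NonZero; z≤n; s≤s; >-nonZero; _≤?_; _<?_; _<ᵇ_)
open import Data.Nat.Properties
open import Data.Nat.DivMod using (m%n<n; [m+kn]%n≡m%n; m<n⇒m%n≡m; m/n*n≤m; m≥n⇒m/n>0)
open import Data.Bool using (Bool; true; false; not; T)
open import Data.Fin using (Fin; zero; suc; toℕ; fromℕ<; inject≤; combine; finToFun; funToFin)
open import Data.Fin.Properties
  using (toℕ-fromℕ<; toℕ-inject≤; toℕ-combine; toℕ<n; toℕ-injective; inject≤-injective; combine-injectiveˡ; finToFun-funToFin; pigeonhole; 2↔Bool)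
open import Data.Fin.Induction using (<-wellFounded)
open import Data.Fin.Subset using (Subset; _∈_; _∉_; _⊆_; ∣_∣; ⊥; ∁; _∪_; ⁅_⁆)
open import Data.Fin.Subset.Properties
  using (∉⊥; ∣⊥∣≡0; ∣∁p∣≡n∸∣p∣; x∈∁p⇒x∉p; x∈p∪q⁺; x∈p∪q⁻; x∈⁅x⁆; ∣⁅x⁆∣≡1; x∈p⇒∣p-x∣<∣p∣; ∪-identityˡ; ∪-identityʳ)
open import Data.Vec using ([]; _∷_; here; there; tabulate; lookup)
open import Data.Vec.Properties using (tabulate∘lookup; tabulate-cong)
import Data.Vec.Functional as Vector
open import Data.Product using (Σ; ∃-syntax; _×_; _,_; proj₁; proj₂)
open import Data.Sum using (_⊎_; inj₁; inj₂)
open import Data.Sum.Properties using (inj₁-injective; inj₂-injective)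
open import Data.Empty using (⊥-elim) renaming (⊥ to ∅)
open import Function using (_∘_; Inverse)
open import Function.Definitions using (Injective)
open import Induction.WellFounded using (module All)
open import Relation.Nullary using (¬_; yes; no; contradiction)
open import Relation.Binary.PropositionalEquality
open import Algebra.Properties.CommutativeMonoid.Sum +-0-commutativeMonoid using (sum; ∑-distrib-+; sum-cong-≗)

∣p∪q∣≤∣p∣+∣q∣ : ∀ {n} (p q : Subset n) → ∣ p ∪ q ∣ ≤ ∣ p ∣ + ∣ q ∣
∣p∪q∣≤∣p∣+∣q∣ []          []          = z≤n
∣p∪q∣≤∣p∣+∣q∣ (true ∷ p)  (true ∷ q)  = s≤s (≤-trans (∣p∪q∣≤∣p∣+∣q∣ p q) (+-monoʳ-≤ ∣ p ∣ (n≤1+n ∣ q ∣)))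
∣p∪q∣≤∣p∣+∣q∣ (true ∷ p)  (false ∷ q) = s≤s (∣p∪q∣≤∣p∣+∣q∣ p q)
∣p∪q∣≤∣p∣+∣q∣ (false ∷ p) (true ∷ q)  = ≤-trans (s≤s (∣p∪q∣≤∣p∣+∣q∣ p q)) (≤-reflexive (sym (+-suc ∣ p ∣ ∣ q ∣)))
∣p∪q∣≤∣p∣+∣q∣ (false ∷ p) (false ∷ q) = ∣p∪q∣≤∣p∣+∣q∣ p q

x∈p⇒0<∣p∣ : ∀ {n} {x : Fin n} {p : Subset n} → x ∈ p → 0 < ∣ p ∣
x∈p⇒0<∣p∣ x∈p = ≤-trans (s≤s z≤n) (x∈p⇒∣p-x∣<∣p∣ x∈p)

∣p∣+k≤n⇒k≤∣∁p∣ : ∀ {n} k (p : Subset n) → ∣ p ∣ + k ≤ n → k ≤ ∣ ∁ p ∣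
∣p∣+k≤n⇒k≤∣∁p∣ {n} k p le = begin
  k              ≡⟨ m+n∸m≡n ∣ p ∣ k ⟨
  ∣ p ∣ + k ∸ ∣ p ∣ ≤⟨ ∸-monoˡ-≤ ∣ p ∣ le ⟩
  n ∸ ∣ p ∣      ≡⟨ ∣∁p∣≡n∸∣p∣ p ⟨
  ∣ ∁ p ∣        ∎
  where open ≤-Reasoning

pick : ∀ {n} → ℕ → Subset n → Subset n
pick k             []          = []
pick zero          (_ ∷ p)     = false ∷ pick zero p
pick (suc k)       (true ∷ p)  = true ∷ pick k p
pick (suc k)       (false ∷ p) = false ∷ pick (suc k) p

pick⊆ : ∀ {n} k (p : Subset n) → pick k p ⊆ p
pick⊆ zero    (_ ∷ p)     (there x∈) = there (pick⊆ zero p x∈)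
pick⊆ (suc k) (true ∷ p)  here       = here
pick⊆ (suc k) (true ∷ p)  (there x∈) = there (pick⊆ k p x∈)
pick⊆ (suc k) (false ∷ p) (there x∈) = there (pick⊆ (suc k) p x∈)

∣pick∣≤ : ∀ {n} k (p : Subset n) → ∣ pick k p ∣ ≤ k
∣pick∣≤ k       []          = z≤n
∣pick∣≤ zero    (_ ∷ p)     = ∣pick∣≤ zero p
∣pick∣≤ (suc k) (true ∷ p)  = s≤s (∣pick∣≤ k p)
∣pick∣≤ (suc k) (false ∷ p) = ∣pick∣≤ (suc k) p

∣pick∣≡ : ∀ {n} k (p : Subset n) → k ≤ ∣ p ∣ → ∣ pick k p ∣ ≡ k
∣pick∣≡ zero    []          _         = refl
∣pick∣≡ zero    (_ ∷ p)     _         = ∣pick∣≡ zero p z≤n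
∣pick∣≡ (suc k) (true ∷ p)  (s≤s k≤) = cong suc (∣pick∣≡ k p k≤)
∣pick∣≡ (suc k) (false ∷ p) k≤       = ∣pick∣≡ (suc k) p k≤

sum-mono-≤ : ∀ {n} {f g : Fin n → ℕ} → (∀ i → f i ≤ g i) → sum f ≤ sum g
sum-mono-≤ {zero}  f≤g = z≤n
sum-mono-≤ {suc n} f≤g = +-mono-≤ (f≤g zero) (sum-mono-≤ (f≤g ∘ suc))

sum-const : ∀ n k → sum {n} (λ _ → k) ≡ n * k
sum-const zero    k = refl
sum-const (suc n) k = cong (k +_) (sum-const n k)

sum-∸1 : ∀ {n} (f : Fin n → ℕ) → (∀ i → 1 ≤ f i) → sum (λ i → f i ∸ 1) + n ≡ sum f
sum-∸1 {n} f 1≤f = begin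
  sum (λ i → f i ∸ 1) + n               ≡⟨ cong (sum (λ i → f i ∸ 1) +_) (sym (trans (sum-const n 1) (*-identityʳ n))) ⟩
  sum (λ i → f i ∸ 1) + sum {n} (λ _ → 1) ≡⟨ ∑-distrib-+ (λ i → f i ∸ 1) (λ _ → 1) ⟨
  sum (λ i → f i ∸ 1 + 1)               ≡⟨ sum-cong-≗ (λ i → m∸n+n≡m (1≤f i)) ⟩
  sum f                                 ∎
  where open ≡-Reasoning

sum-zero : ∀ {n} {f : Fin n → ℕ} → (∀ i → f i ≡ 0) → sum f ≡ 0
sum-zero {n} f≡0 = trans (sum-cong-≗ f≡0) (trans (sum-const n 0) (*-zeroʳ n))

⋃ᶠ : ∀ {t n} → (Fin t → Subset n) → Subset n
⋃ᶠ = Vector.foldr _∪_ ⊥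

⊆⋃ᶠ : ∀ {t n} (f : Fin t → Subset n) x → f x ⊆ ⋃ᶠ f
⊆⋃ᶠ {suc t} f zero    c∈ = x∈p∪q⁺ (inj₁ c∈)
⊆⋃ᶠ {suc t} f (suc x) c∈ = x∈p∪q⁺ (inj₂ (⊆⋃ᶠ (f ∘ suc) x c∈))

∑∣⋃ᶠ∣≤ : ∀ {t s r} (f : Fin t → Fin s → Subset r) →
         (∀ x → sum (λ i → ∣ f x i ∣) ≤ 1) → sum (λ i → ∣ ⋃ᶠ (λ x → f x i) ∣) ≤ t
∑∣⋃ᶠ∣≤ {zero} {s} {r} f f≤1 = ≤-reflexive (sum-zero {s} (λ _ → ∣⊥∣≡0 r))
∑∣⋃ᶠ∣≤ {suc t}         f f≤1 = begin
  sum (λ i → ∣ f zero i ∪ rest i ∣)          ≤⟨ sum-mono-≤ (λ i → ∣p∪q∣≤∣p∣+∣q∣ (f zero i) (rest i)) ⟩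
  sum (λ i → ∣ f zero i ∣ + ∣ rest i ∣)       ≡⟨ ∑-distrib-+ (λ i → ∣ f zero i ∣) (λ i → ∣ rest i ∣) ⟩
  sum (λ i → ∣ f zero i ∣) + sum (λ i → ∣ rest i ∣)
                                             ≤⟨ +-mono-≤ (f≤1 zero) (∑∣⋃ᶠ∣≤ (f ∘ suc) (f≤1 ∘ suc)) ⟩
  suc t                                      ∎
  where
  open ≤-Reasoning
  rest = λ i → ⋃ᶠ (λ x → f (suc x) i)

singletonAt : ∀ {s r} → Fin s → Fin r → Fin s → Subset r
singletonAt zero    c zero    = ⁅ c ⁆
singletonAt zero    c (suc _) = ⊥
singletonAt (suc _) c zero    = ⊥
singletonAt (suc ι) c (suc i) = singletonAt ι c i

∈singletonAt : ∀ {s r} (ι : Fin s) (c : Fin r) → c ∈ singletonAt ι c ι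
∈singletonAt zero    c = x∈⁅x⁆ c
∈singletonAt (suc ι) c = ∈singletonAt ι c

∑∣singletonAt∣≡1 : ∀ {s r} (ι : Fin s) (c : Fin r) → sum (λ i → ∣ singletonAt ι c i ∣) ≡ 1
∑∣singletonAt∣≡1 {suc s} {r} zero c =
  cong₂ _+_ (∣⁅x⁆∣≡1 c) (sum-zero {s} (λ _ → ∣⊥∣≡0 r))
∑∣singletonAt∣≡1 {suc s} {r} (suc ι) c =
  cong₂ _+_ (∣⊥∣≡0 r) (∑∣singletonAt∣≡1 ι c)

residue : ∀ {N} P .{{_ : NonZero P}} → Fin N → Fin P
residue P b = fromℕ< (m%n<n (toℕ b) P)

-- The number P * j + e, so copies of e have residue e mod P.
copy : ∀ {c P N} → c * P ≤ N → Fin c → Fin P → Fin N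
copy c*P≤N j e = inject≤ (combine j e) c*P≤N

residue-copy : ∀ {c P N} .{{_ : NonZero P}} (le : c * P ≤ N) (j : Fin c) (e : Fin P) → residue P (copy le j e) ≡ e
residue-copy {P = P} le j e = toℕ-injective (begin
  toℕ (residue P (copy le j e))  ≡⟨ toℕ-fromℕ< _ ⟩
  toℕ (copy le j e) % P          ≡⟨ cong (_% P) (trans (toℕ-inject≤ (combine j e) le) (toℕ-combine j e)) ⟩
  (P * toℕ j + toℕ e) % P        ≡⟨ cong (_% P) (+-comm (P * toℕ j) (toℕ e)) ⟩
  (toℕ e + P * toℕ j) % P        ≡⟨ cong (λ x → (toℕ e + x) % P) (*-comm P (toℕ j)) ⟩
  (toℕ e + toℕ j * P) % P        ≡⟨ [m+kn]%n≡m%n (toℕ e) (toℕ j) P ⟩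
  toℕ e % P                      ≡⟨ m<n⇒m%n≡m (toℕ<n e) ⟩
  toℕ e                          ∎)
  where open ≡-Reasoning

copy-injectiveˡ : ∀ {c P N} (le : c * P ≤ N) {j j′ : Fin c} (e e′ : Fin P) → copy le j e ≡ copy le j′ e′ → j ≡ j′
copy-injectiveˡ le {j} {j′} e e′ eq = combine-injectiveˡ j e j′ e′ (inject≤-injective le le _ _ eq)

decodeSubset : ∀ {r} → Fin (2 ^ r) → Subset r
decodeSubset x = tabulate (Inverse.to 2↔Bool ∘ finToFun x)

encodeSubset : ∀ {r} → Subset r → Fin (2 ^ r)
encodeSubset p = funToFin (Inverse.from 2↔Bool ∘ lookup p)

decodeSubset-encodeSubset : ∀ {r} (p : Subset r) → decodeSubset (encodeSubset p) ≡ p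
decodeSubset-encodeSubset p = trans
  (tabulate-cong (λ c → trans (cong (Inverse.to 2↔Bool) (finToFun-funToFin _ c)) (Inverse.strictlyInverseˡ 2↔Bool (lookup p c))))
  (tabulate∘lookup p)

SubsetTuples : ℕ → ℕ → ℕ
SubsetTuples r s = (2 ^ r) ^ s

decodeTuple : ∀ {r s} → Fin (SubsetTuples r s) → Fin s → Subset r
decodeTuple x i = decodeSubset (finToFun x i)

encodeTuple : ∀ {r s} → (Fin s → Subset r) → Fin (SubsetTuples r s)
encodeTuple C = funToFin (encodeSubset ∘ C)

decodeTuple-encodeTuple : ∀ {r s} (C : Fin s → Subset r) i → decodeTuple (encodeTuple C) i ≡ C i
decodeTuple-encodeTuple C i = trans (cong decodeSubset (finToFun-funToFin _ i)) (decodeSubset-encodeSubset (C i))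

record Packing (r k s : ℕ) : Set where
  field
    part          : Fin s → Subset r
    ∣part∣≡k      : ∀ i → ∣ part i ∣ ≡ k
    part-disjoint : ∀ {i j c} → c ∈ part i → c ∈ part j → i ≡ j
open Packing

Avoids : ∀ {r k s} → Packing r k s → (Fin s → Subset r) → Set
Avoids P C = ∀ i {c} → c ∈ part P i → c ∉ C i

excess : ∀ {r s} → (Fin s → Subset r) → ℕ
excess C = sum (λ i → ∣ C i ∣ ∸ 1)

module Greedy (k : ℕ) {r : ℕ} where

  quota : Bool → ℕ
  quota true  = k
  quota false = 0

  choice : Bool → Subset r → Subset r → Subset r
  choice true  c U = pick k (∁ (c ∪ U))
  choice false c U = ⊥

  fill : ∀ {s} → (Fin s → Bool) → (Fin s → Subset r) → Subset r → Fin s → Subset r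
  fill sel C U zero    = choice (sel zero) (C zero) U
  fill sel C U (suc i) = fill (sel ∘ suc) (C ∘ suc) (U ∪ choice (sel zero) (C zero) U) i

  used : ∀ {s} → (Fin s → Bool) → (Fin s → Subset r) → Subset r → Subset r
  used {zero}  sel C U = U
  used {suc s} sel C U = used (sel ∘ suc) (C ∘ suc) (U ∪ choice (sel zero) (C zero) U)

  choice-avoids : ∀ b c U {x} → x ∈ choice b c U → x ∉ c × x ∉ U
  choice-avoids true  c U x∈ = (λ x∈c → x∉c∪U (x∈p∪q⁺ (inj₁ x∈c))) , (λ x∈U → x∉c∪U (x∈p∪q⁺ (inj₂ x∈U)))
    where x∉c∪U = x∈∁p⇒x∉p (pick⊆ k (∁ (c ∪ U)) x∈)
  choice-avoids false c U x∈ = contradiction x∈ ∉⊥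

  ∣choice∣≤quota : ∀ b c U → ∣ choice b c U ∣ ≤ quota b
  ∣choice∣≤quota true  c U = ∣pick∣≤ k (∁ (c ∪ U))
  ∣choice∣≤quota false c U = ≤-reflexive (∣⊥∣≡0 r)

  fill-avoids : ∀ {s} sel C U (i : Fin s) {x} → x ∈ fill sel C U i → x ∉ C i × x ∉ U
  fill-avoids sel C U zero    x∈ = choice-avoids (sel zero) (C zero) U x∈
  fill-avoids sel C U (suc i) x∈ with fill-avoids (sel ∘ suc) (C ∘ suc) _ i x∈
  ... | x∉C , x∉U′ = x∉C , (λ x∈U → x∉U′ (x∈p∪q⁺ (inj₁ x∈U)))

  fill-disjoint : ∀ {s} sel C U {i j : Fin s} {x} → x ∈ fill sel C U i → x ∈ fill sel C U j → i ≡ j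
  fill-disjoint sel C U {zero}  {zero}  x∈ x∈′ = refl
  fill-disjoint sel C U {zero}  {suc j} x∈ x∈′ =
    contradiction (x∈p∪q⁺ (inj₂ x∈)) (proj₂ (fill-avoids (sel ∘ suc) (C ∘ suc) _ j x∈′))
  fill-disjoint sel C U {suc i} {zero}  x∈ x∈′ =
    contradiction (x∈p∪q⁺ (inj₂ x∈′)) (proj₂ (fill-avoids (sel ∘ suc) (C ∘ suc) _ i x∈))
  fill-disjoint sel C U {suc i} {suc j} x∈ x∈′ = cong suc (fill-disjoint (sel ∘ suc) (C ∘ suc) _ x∈ x∈′)

  ⊆used : ∀ {s} (sel : Fin s → Bool) C U → U ⊆ used sel C U
  ⊆used {zero}  sel C U x∈ = x∈
  ⊆used {suc s} sel C U x∈ = ⊆used (sel ∘ suc) (C ∘ suc) _ (x∈p∪q⁺ (inj₁ x∈))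

  fill⊆used : ∀ {s} sel C U (i : Fin s) → fill sel C U i ⊆ used sel C U
  fill⊆used sel C U zero    x∈ = ⊆used (sel ∘ suc) (C ∘ suc) _ (x∈p∪q⁺ (inj₂ x∈))
  fill⊆used sel C U (suc i) x∈ = fill⊆used (sel ∘ suc) (C ∘ suc) _ i x∈

  ∣used∣≤ : ∀ {s} sel C U → ∣ used {s} sel C U ∣ ≤ ∣ U ∣ + sum (quota ∘ sel)
  ∣used∣≤ {zero}  sel C U = ≤-reflexive (sym (+-identityʳ ∣ U ∣))
  ∣used∣≤ {suc s} sel C U = begin
    ∣ used (sel ∘ suc) (C ∘ suc) (U ∪ c₀) ∣            ≤⟨ ∣used∣≤ (sel ∘ suc) (C ∘ suc) (U ∪ c₀) ⟩
    ∣ U ∪ c₀ ∣ + sum (quota ∘ sel ∘ suc)               ≤⟨ +-monoˡ-≤ _ (∣p∪q∣≤∣p∣+∣q∣ U c₀) ⟩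
    ∣ U ∣ + ∣ c₀ ∣ + sum (quota ∘ sel ∘ suc)           ≤⟨ +-monoˡ-≤ _ (+-monoʳ-≤ ∣ U ∣ (∣choice∣≤quota (sel zero) (C zero) U)) ⟩
    ∣ U ∣ + quota (sel zero) + sum (quota ∘ sel ∘ suc) ≡⟨ +-assoc ∣ U ∣ _ _ ⟩
    ∣ U ∣ + sum (quota ∘ sel)                          ∎
    where
    open ≤-Reasoning
    c₀ = choice (sel zero) (C zero) U

  -- Invariant: the colours used so far plus the budgets a of the remaining
  -- indices fit into B; room says a selected index always has enough space left.
  ∣fill∣≡k : ∀ {s} sel C U (a : Fin s → ℕ) B →
             (∀ i → quota (sel i) ≤ a i) →
             (∀ i → sel i ≡ true → ∀ u → u + a i ≤ B → ∣ C i ∣ + u + k ≤ r) →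
             ∣ U ∣ + sum a ≤ B → ∀ i → sel i ≡ true → ∣ fill sel C U i ∣ ≡ k
  ∣fill∣≡k sel C U a B quota≤a room fits zero sel₀ rewrite sel₀ =
    ∣pick∣≡ k (∁ (C zero ∪ U)) (∣p∣+k≤n⇒k≤∣∁p∣ k (C zero ∪ U) (begin
      ∣ C zero ∪ U ∣ + k       ≤⟨ +-monoˡ-≤ k (∣p∪q∣≤∣p∣+∣q∣ (C zero) U) ⟩
      ∣ C zero ∣ + ∣ U ∣ + k   ≤⟨ room zero sel₀ ∣ U ∣ (≤-trans (+-monoʳ-≤ ∣ U ∣ (m≤m+n (a zero) _)) fits) ⟩
      r                        ∎))
    where open ≤-Reasoning
  ∣fill∣≡k sel C U a B quota≤a room fits (suc i) seli =
    ∣fill∣≡k (sel ∘ suc) (C ∘ suc) (U ∪ c₀) (a ∘ suc) B (quota≤a ∘ suc) (room ∘ suc) fits′ i seli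
    where
    open ≤-Reasoning
    c₀ = choice (sel zero) (C zero) U
    fits′ : ∣ U ∪ c₀ ∣ + sum (a ∘ suc) ≤ B
    fits′ = begin
      ∣ U ∪ c₀ ∣ + sum (a ∘ suc)          ≤⟨ +-monoˡ-≤ _ (∣p∪q∣≤∣p∣+∣q∣ U c₀) ⟩
      ∣ U ∣ + ∣ c₀ ∣ + sum (a ∘ suc)      ≤⟨ +-monoˡ-≤ _ (+-monoʳ-≤ ∣ U ∣ (≤-trans (∣choice∣≤quota (sel zero) (C zero) U) (quota≤a zero))) ⟩
      ∣ U ∣ + a zero + sum (a ∘ suc)      ≡⟨ +-assoc ∣ U ∣ _ _ ⟩
      ∣ U ∣ + sum a                       ≤⟨ fits ⟩
      B                                   ∎

  fill-unselected : ∀ {s} sel C U (i : Fin s) → sel i ≡ false → fill sel C U i ≡ ⊥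
  fill-unselected sel C U zero    sel₀ rewrite sel₀ = refl
  fill-unselected sel C U (suc i) seli = fill-unselected (sel ∘ suc) (C ∘ suc) _ i seli

  quota+quota∘not : ∀ b → quota b + quota (not b) ≡ k
  quota+quota∘not true  = +-identityʳ k
  quota+quota∘not false = refl

  -- First serve the indices with ∣ C i ∣ > k, paying for each with the
  -- excess of C, then the small ones, which fit because s k colours remain.
  module TwoPhase {s} (C : Fin s → Subset r) where

    big : Fin s → Bool
    big i = k <ᵇ ∣ C i ∣

    first second greedyPart : Fin s → Subset r
    first  = fill big C ⊥
    second = fill (not ∘ big) C (used big C ⊥)
    greedyPart i = first i ∪ second i

    greedyPart-avoids : ∀ i {x} → x ∈ greedyPart i → x ∉ C i
    greedyPart-avoids i x∈ with x∈p∪q⁻ (first i) (second i) x∈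
    ... | inj₁ x∈first  = proj₁ (fill-avoids big C ⊥ i x∈first)
    ... | inj₂ x∈second = proj₁ (fill-avoids (not ∘ big) C _ i x∈second)

    greedyPart-disjoint : ∀ {i j x} → x ∈ greedyPart i → x ∈ greedyPart j → i ≡ j
    greedyPart-disjoint {i} {j} x∈i x∈j with x∈p∪q⁻ (first i) (second i) x∈i | x∈p∪q⁻ (first j) (second j) x∈j
    ... | inj₁ x∈ | inj₁ x∈′ = fill-disjoint big C ⊥ x∈ x∈′
    ... | inj₂ x∈ | inj₂ x∈′ = fill-disjoint (not ∘ big) C _ x∈ x∈′
    ... | inj₁ x∈ | inj₂ x∈′ = contradiction (fill⊆used big C ⊥ i x∈) (proj₂ (fill-avoids (not ∘ big) C _ j x∈′))
    ... | inj₂ x∈ | inj₁ x∈′ = contradiction (fill⊆used big C ⊥ j x∈′) (proj₂ (fill-avoids (not ∘ big) C _ i x∈))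

    module _ (excess+k<r : excess C + k < r) (room : ∀ i → ∣ C i ∣ ≤ k → ∣ C i ∣ + s * k ≤ r) where

      ∣first∣≡k : ∀ i → big i ≡ true → ∣ first i ∣ ≡ k
      ∣first∣≡k = ∣fill∣≡k big C ⊥ (λ i → ∣ C i ∣ ∸ 1) (excess C) quota≤ room₁
                    (≤-reflexive (cong (_+ excess C) (∣⊥∣≡0 r)))
        where
        k<∣C∣ : ∀ {i} → big i ≡ true → k < ∣ C i ∣
        k<∣C∣ {i} bigi = <ᵇ⇒< k ∣ C i ∣ (subst T (sym bigi) _)
        quota≤ : ∀ i → quota (big i) ≤ ∣ C i ∣ ∸ 1
        quota≤ i with big i in bigi
        ... | true  = ≤-pred (≤-trans (k<∣C∣ bigi) (≤-reflexive (sym (suc-pred ∣ C i ∣ {{>-nonZero (m<n⇒0<n (k<∣C∣ bigi))}}))))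
        ... | false = z≤n
        room₁ : ∀ i → big i ≡ true → ∀ u → u + (∣ C i ∣ ∸ 1) ≤ excess C → ∣ C i ∣ + u + k ≤ r
        room₁ i bigi u u+a≤ = begin
          ∣ C i ∣ + u + k                ≡⟨ cong (λ x → x + u + k) (suc-pred ∣ C i ∣ {{>-nonZero (m<n⇒0<n (k<∣C∣ bigi))}}) ⟨
          suc (∣ C i ∣ ∸ 1 + u) + k      ≤⟨ +-monoˡ-≤ k (s≤s (≤-trans (≤-reflexive (+-comm _ u)) u+a≤)) ⟩
          suc (excess C + k)             ≤⟨ excess+k<r ⟩
          r                              ∎
          where open ≤-Reasoning

      ∣second∣≡k : ∀ i → big i ≡ false → ∣ second i ∣ ≡ k
      ∣second∣≡k i bigi = ∣fill∣≡k (not ∘ big) C (used big C ⊥) (quota ∘ not ∘ big) (s * k) (λ _ → ≤-refl) room₂ fits i (cong not bigi)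
        where
        open ≤-Reasoning
        room₂ : ∀ i → not (big i) ≡ true → ∀ u → u + quota (not (big i)) ≤ s * k → ∣ C i ∣ + u + k ≤ r
        room₂ i small u u+k≤ with big i in bigi
        ... | false = begin
          ∣ C i ∣ + u + k     ≡⟨ +-assoc ∣ C i ∣ u k ⟩
          ∣ C i ∣ + (u + k)   ≤⟨ +-monoʳ-≤ ∣ C i ∣ u+k≤ ⟩
          ∣ C i ∣ + s * k     ≤⟨ room i ∣C∣≤k ⟩
          r                   ∎
          where
          ∣C∣≤k : ∣ C i ∣ ≤ k
          ∣C∣≤k = ≮⇒≥ (λ k<∣C∣ → subst T bigi (<⇒<ᵇ k<∣C∣))
        fits : ∣ used big C ⊥ ∣ + sum (quota ∘ not ∘ big) ≤ s * k
        fits = begin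
          ∣ used big C ⊥ ∣ + sum (quota ∘ not ∘ big)               ≤⟨ +-monoˡ-≤ _ (∣used∣≤ big C ⊥) ⟩
          ∣ ⊥ {r} ∣ + sum (quota ∘ big) + sum (quota ∘ not ∘ big)  ≡⟨ cong (λ x → x + sum (quota ∘ big) + sum (quota ∘ not ∘ big)) (∣⊥∣≡0 r) ⟩
          sum (quota ∘ big) + sum (quota ∘ not ∘ big)              ≡⟨ ∑-distrib-+ (quota ∘ big) (quota ∘ not ∘ big) ⟨
          sum (λ i → quota (big i) + quota (not (big i)))          ≡⟨ sum-cong-≗ (quota+quota∘not ∘ big) ⟩
          sum {s} (λ _ → k)                                        ≡⟨ sum-const s k ⟩
          s * k                                                    ∎

      ∣greedyPart∣≡k : ∀ i → ∣ greedyPart i ∣ ≡ k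
      ∣greedyPart∣≡k i with big i in bigi
      ... | true  = trans (cong (λ q → ∣ first i ∪ q ∣) (fill-unselected (not ∘ big) C _ i (cong not bigi)))
                      (trans (cong ∣_∣ (∪-identityʳ (first i))) (∣first∣≡k i bigi))
      ... | false = trans (cong (λ p → ∣ p ∪ second i ∣) (fill-unselected big C ⊥ i bigi))
                      (trans (cong ∣_∣ (∪-identityˡ (second i))) (∣second∣≡k i bigi))

greedyPacking : ∀ {r s} k (C : Fin s → Subset r) → excess C + k < r → (∀ i → ∣ C i ∣ ≤ k → ∣ C i ∣ + s * k ≤ r) →
                Σ (Packing r k s) (λ P → Avoids P C)
greedyPacking k C excess+k<r room =
  record { part = greedyPart ; ∣part∣≡k = ∣greedyPart∣≡k excess+k<r room ; part-disjoint = greedyPart-disjoint }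
  , greedyPart-avoids
  where open Greedy.TwoPhase k C

module _ {r k n m} {φ : Colouring r k n m} where

  monoTree-all : (T : MonoTree φ) (P : Vertex n m → Set) → P (vertex T zero) →
                 (∀ {u v} → ColEdge φ (colour T) u v → P v → P u) → ∀ j → P (vertex T j)
  monoTree-all T P P₀ step = All.wfRec <-wellFounded _ (P ∘ vertex T) go
    where
    go : ∀ j → (∀ {j′} → toℕ j′ < toℕ j → P (vertex T j′)) → P (vertex T j)
    go zero    _  = P₀
    go (suc j) ih = step (edge T j) (ih (s≤s (parent≤ T j)))

  monoTree-confined : ∀ {I : Set} (Q : I → Vertex n m → Set) (T : MonoTree φ) →
    (∀ {u v} → ColEdge φ (colour T) u v → Σ I λ ι → Q ι u × Q ι v) →
    (∀ {ι u v} → ColEdge φ (colour T) u v → Q ι v → Q ι u) →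
    size T ≡ 0 ⊎ Σ I λ ι → ∀ j → Q ι (vertex T j)
  monoTree-confined Q record { size = zero } edge-in step = inj₁ refl
  monoTree-confined Q T@record { size = suc _ ; parent = p ; parent≤ = p≤ ; edge = e } edge-in step
    with p zero | p≤ zero | e zero
  ... | zero | _ | e₀ with edge-in e₀
  ... | ι , _ , Q₀ = inj₂ (ι , monoTree-all T (Q ι) Q₀ step)

  singletons-cannot-cover : ∀ {t′ t} (T : Fin t′ → MonoTree φ) → t′ ≤ t →
    (∀ v → ∃[ x ] ∃[ y ] vertex (T x) y ≡ v) →
    (w : Fin (suc t) → Vertex n m) → Injective _≡_ _≡_ w →
    ¬ (∀ j x y → vertex (T x) y ≡ w j → size (T x) ≡ 0)
  singletons-cannot-cover T t′≤t covers w w-injective singleton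
    with pigeonhole (s≤s t′≤t) (λ j → proj₁ (covers (w j)))
  ... | j , j′ , j<j′ , same-tree with covers (w j) | covers (w j′)
  ... | x , y , vy≡wj | x′ , y′ , vy′≡wj′ with refl ← same-tree =
    <-irrefl (cong toℕ (w-injective (begin
      w j               ≡⟨ vy≡wj ⟨
      vertex (T x) y    ≡⟨ single (size (T x)) (vertex (T x)) (singleton j x y vy≡wj) y y′ ⟩
      vertex (T x) y′   ≡⟨ vy′≡wj′ ⟩
      w j′              ∎))) j<j′
    where
    open ≡-Reasoning
    single : ∀ {A : Set} sz (f : Fin (suc sz) → A) → sz ≡ 0 → ∀ y y′ → f y ≡ f y′
    single .0 f refl zero zero = refl

small-parts-fit : ∀ {r k s} → s ≡ 1 ⊎ suc s * k ≤ r → (C : Fin s → Subset r) → excess C + k < r →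
                  ∀ i → ∣ C i ∣ ≤ k → ∣ C i ∣ + s * k ≤ r
small-parts-fit {r} {k} (inj₁ refl) C excess+k<r zero ∣C∣≤k = begin
  ∣ C zero ∣ + 1 * k               ≡⟨ cong (∣ C zero ∣ +_) (*-identityˡ k) ⟩
  ∣ C zero ∣ + k                   ≤⟨ +-monoˡ-≤ k (m≤n+m∸n ∣ C zero ∣ 1) ⟩
  suc (∣ C zero ∣ ∸ 1) + k         ≡⟨ cong (λ e → suc e + k) (+-identityʳ (∣ C zero ∣ ∸ 1)) ⟨
  suc (excess C + k)               ≤⟨ excess+k<r ⟩
  r                                ∎
  where open ≤-Reasoning
small-parts-fit {k = k} {s} (inj₂ sk+k≤r) C _ i ∣C∣≤k = ≤-trans (+-monoˡ-≤ (s * k) ∣C∣≤k) sk+k≤r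

module _ {r k s} (k<r : k < r) (spacious : s ≡ 1 ⊎ suc s * k ≤ r) where

  -- When excess C is too large, any packing will do; we take one for the empty sets.
  packingFor : (Fin s → Subset r) → Packing r k s
  packingFor C with excess C + k <? r
  ... | yes excess+k<r = proj₁ (greedyPacking k C excess+k<r (small-parts-fit spacious C excess+k<r))
  ... | no _           = proj₁ (greedyPacking k (λ _ → ⊥) empty-fits (small-parts-fit spacious (λ _ → ⊥) empty-fits))
    where
    empty-fits : excess {r} {s} (λ _ → ⊥) + k < r
    empty-fits = subst (λ e → e + k < r) (sym (sum-zero {s} (λ _ → cong (_∸ 1) (∣⊥∣≡0 r)))) k<r

  packingFor-avoids : ∀ C → excess C + k < r → Avoids (packingFor C) C
  packingFor-avoids C excess+k<r with excess C + k <? r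
  ... | yes excess+k<r′ = proj₂ (greedyPacking k C excess+k<r′ (small-parts-fit spacious C excess+k<r′))
  ... | no excess+k≮r   = contradiction excess+k<r excess+k≮r

-- A vertex of side A lies in the class of its residue mod s; a vertex of side B
-- carries the family of colour sets that its residue encodes.
module Construction {r k s} .{{_ : NonZero s}} (k<r : k < r) (spacious : s ≡ 1 ⊎ suc s * k ≤ r) (n m : ℕ) where

  instance
    tuples-nonZero : NonZero (SubsetTuples r s)
    tuples-nonZero = m^n≢0 (2 ^ r) s {{m^n≢0 2 r}}

  classOf : Fin n → Fin s
  classOf = residue s

  codeOf : Fin m → Fin s → Subset r
  codeOf b = decodeTuple (residue (SubsetTuples r s) b)

  packingAt : Fin m → Packing r k s
  packingAt b = packingFor k<r spacious (codeOf b)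

  φ : Colouring r k n m
  φ = record { col = λ a b → part (packingAt b) (classOf a) ; size = λ a b → ∣part∣≡k (packingAt b) (classOf a) }

  InClass : Fin s → Fin r → Vertex n m → Set
  InClass ι c (inj₁ a) = classOf a ≡ ι
  InClass ι c (inj₂ b) = c ∈ part (packingAt b) ι

  inClass-unique : ∀ {ι ι′ c} v → InClass ι c v → InClass ι′ c v → ι ≡ ι′
  inClass-unique (inj₁ a) refl refl = refl
  inClass-unique (inj₂ b) c∈ c∈′    = part-disjoint (packingAt b) c∈ c∈′

  edge-inClass : ∀ {c} u v → ColEdge φ c u v → Σ (Fin s) λ ι → InClass ι c u × InClass ι c v
  edge-inClass (inj₁ a) (inj₂ b) c∈ = classOf a , refl , c∈
  edge-inClass (inj₂ b) (inj₁ a) c∈ = classOf a , c∈ , refl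

  inClass-step : ∀ {ι c} u v → ColEdge φ c u v → InClass ι c v → InClass ι c u
  inClass-step (inj₁ a) v@(inj₂ b) c∈ c∈′ = inClass-unique v c∈ c∈′
  inClass-step (inj₂ b) (inj₁ a) c∈ refl = c∈

  monoTree-shape : (T : MonoTree φ) → size T ≡ 0 ⊎ Σ (Fin s) λ ι → ∀ j → InClass ι (colour T) (vertex T j)
  monoTree-shape T = monoTree-confined (λ ι → InClass ι (colour T)) T (edge-inClass _ _) (inClass-step _ _)

  packingAt-avoids : ∀ b (C : Fin s → Subset r) → (∀ i → codeOf b i ≡ C i) → excess C + k < r → Avoids (packingAt b) C
  packingAt-avoids b C code≗C excess+k<r i c∈ c∈C =
    packingFor-avoids k<r spacious (codeOf b) (subst (λ e → e + k < r) (sym (sum-cong-≗ (λ i → cong (λ p → ∣ p ∣ ∸ 1) (code≗C i)))) excess+k<r) i c∈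
      (subst (_ ∈_) (sym (code≗C i)) c∈C)

  classColours : ∀ {A : Set} {P : Fin s → Set} → Fin r → A ⊎ Σ (Fin s) P → Fin s → Subset r
  classColours c (inj₁ _)       = λ _ → ⊥
  classColours c (inj₂ (ι , _)) = singletonAt ι c

  ∑∣classColours∣≤1 : ∀ {A : Set} {P : Fin s → Set} c (sh : A ⊎ Σ (Fin s) P) → sum (λ i → ∣ classColours c sh i ∣) ≤ 1
  ∑∣classColours∣≤1 c (inj₁ _)       = ≤-trans (≤-reflexive (sum-zero {s} (λ _ → ∣⊥∣≡0 r))) z≤n
  ∑∣classColours∣≤1 c (inj₂ (ι , _)) = ≤-reflexive (∑∣singletonAt∣≡1 ι c)

  module Cover {t t′} (T : Fin t′ → MonoTree φ) (t′≤t : t′ ≤ t) (covers : ∀ v → ∃[ x ] ∃[ y ] vertex (T x) y ≡ v) where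

    colours : Fin s → Subset r
    colours i = ⋃ᶠ (λ x → classColours (colour (T x)) (monoTree-shape (T x)) i)

    ∑∣colours∣≤t : sum (λ i → ∣ colours i ∣) ≤ t
    ∑∣colours∣≤t = ≤-trans (∑∣⋃ᶠ∣≤ (λ x → classColours (colour (T x)) (monoTree-shape (T x))) (λ x → ∑∣classColours∣≤1 (colour (T x)) (monoTree-shape (T x)))) t′≤t

    colour∈colours : ∀ x y {ι} → InClass ι (colour (T x)) (vertex (T x) y) → size (T x) ≡ 0 ⊎ colour (T x) ∈ colours ι
    colour∈colours x y {ι} inι with monoTree-shape (T x) in shape
    ... | inj₁ trivial    = inj₁ trivial
    ... | inj₂ (ι′ , inι′) with inClass-unique _ (inι′ y) inι
    ... | refl = inj₂ (⊆⋃ᶠ _ x (subst (λ sh → colour (T x) ∈ classColours (colour (T x)) sh ι) (sym shape) (∈singletonAt ι (colour (T x)))))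

    every-class-coloured : suc t * s ≤ n → ∀ i → 1 ≤ ∣ colours i ∣
    every-class-coloured copies-in-A i with 1 ≤? ∣ colours i ∣
    ... | yes 1≤ = 1≤
    ... | no 1≰  = ⊥-elim (singletons-cannot-cover T t′≤t covers w w-injective only-singletons)
      where
      w : Fin (suc t) → Vertex n m
      w j = inj₁ (copy copies-in-A j i)
      w-injective : Injective _≡_ _≡_ w
      w-injective = copy-injectiveˡ copies-in-A i i ∘ inj₁-injective
      only-singletons : ∀ j x y → vertex (T x) y ≡ w j → size (T x) ≡ 0
      only-singletons j x y v≡w
        with colour∈colours x y (subst (InClass i (colour (T x))) (sym v≡w) (residue-copy copies-in-A j i))
      ... | inj₁ trivial = trivial
      ... | inj₂ c∈      = contradiction (x∈p⇒0<∣p∣ c∈) 1≰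

    excess-colours : t < r ∸ k + s → suc t * s ≤ n → excess colours + k < r
    excess-colours t<r∸k+s copies-in-A = begin
      suc (excess colours) + k   ≤⟨ +-monoˡ-≤ k (+-cancelʳ-≤ s (suc (excess colours)) (r ∸ k) (begin
        suc (excess colours + s)     ≡⟨ cong suc (sum-∸1 (λ i → ∣ colours i ∣) (every-class-coloured copies-in-A)) ⟩
        suc (sum (λ i → ∣ colours i ∣)) ≤⟨ s≤s ∑∣colours∣≤t ⟩
        suc t                        ≤⟨ t<r∸k+s ⟩
        r ∸ k + s                    ∎)) ⟩
      r ∸ k + k                  ≡⟨ m∸n+n≡m (<⇒≤ k<r) ⟩
      r                          ∎
      where open ≤-Reasoning

    cannot-cover : t < r ∸ k + s → suc t * s ≤ n → suc t * SubsetTuples r s ≤ m → ∅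
    cannot-cover t<r∸k+s copies-in-A copies-in-B = singletons-cannot-cover T t′≤t covers w w-injective only-singletons
      where
      w : Fin (suc t) → Vertex n m
      w j = inj₂ (copy copies-in-B j (encodeTuple colours))
      w-injective : Injective _≡_ _≡_ w
      w-injective = copy-injectiveˡ copies-in-B _ _ ∘ inj₂-injective
      code≗colours : ∀ j i → codeOf (copy copies-in-B j (encodeTuple colours)) i ≡ colours i
      code≗colours j i = trans (cong (λ e → decodeTuple e i) (residue-copy copies-in-B j _)) (decodeTuple-encodeTuple colours i)
      only-singletons : ∀ j x y → vertex (T x) y ≡ w j → size (T x) ≡ 0
      only-singletons j x y v≡w with monoTree-shape (T x)
      ... | inj₁ trivial = trivial
      ... | inj₂ (ι , inι) with colour∈colours x y (inι y)
      ...   | inj₁ trivial = trivial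
      ...   | inj₂ c∈ = contradiction c∈ (packingAt-avoids _ colours (code≗colours j) (excess-colours t<r∸k+s copies-in-A) ι
                                            (subst (InClass ι (colour (T x))) v≡w (inι y)))

colouring-without-small-tree-cover : ∀ r k s .{{_ : NonZero s}} → k < r → s ≡ 1 ⊎ suc s * k ≤ r →
  ∀ t → t < r ∸ k + s →
  ∃[ m₀ ] ∀ (n m : ℕ) → m₀ ≤ m → m ≤ n → ∃[ φ ] ¬ TcAtMost {r} {k} {n} {m} φ t
colouring-without-small-tree-cover r k s k<r spacious t t<r∸k+s =
  suc t * s + suc t * SubsetTuples r s , λ n m m₀≤m m≤n →
    φ n m , λ (t′ , t′≤t , T , covers) → Cover.cannot-cover n m T t′≤t covers t<r∸k+s
      (≤-trans (m≤m+n (suc t * s) _) (≤-trans m₀≤m m≤n)) (≤-trans (m≤n+m _ (suc t * s)) m₀≤m)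
  where open Construction k<r spacious

theorem1p6 : ∀ (r k : ℕ) .{{_ : NonZero k}} → k < r →
    ∃[ m₀ ] ∀ (n m : ℕ) → m₀ ≤ m → m ≤ n →
      ∃[ φ ] ¬ TcAtMost {r} {k} {n} {m} φ
        (((r ∸ k + 1) ⊔ (r ∸ k + r / k ∸ 1)) ∸ 1)
theorem1p6 r k k<r = colouring-without-small-tree-cover r k s {{>-nonZero 1≤s}} k<r spacious _ bound∸1<r∸k+s
  where
  q = r / k
  s = (q ∸ 1) ⊔ 1
  bound = (r ∸ k + 1) ⊔ (r ∸ k + q ∸ 1)
  1≤q : 1 ≤ q
  1≤q = m≥n⇒m/n>0 (<⇒≤ k<r)
  1≤s : 1 ≤ s
  1≤s = m≤n⊔m (q ∸ 1) 1
  bound∸1<r∸k+s : bound ∸ 1 < r ∸ k + s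
  bound∸1<r∸k+s = ≤-trans (≤-reflexive (m+[n∸m]≡n (≤-trans (m≤n+m 1 (r ∸ k)) (m≤m⊔n _ _))))
    (⊔-lub (+-monoʳ-≤ (r ∸ k) 1≤s)
           (≤-trans (≤-reflexive (+-∸-assoc (r ∸ k) 1≤q)) (+-monoʳ-≤ (r ∸ k) (m≤m⊔n (q ∸ 1) 1))))
  -- s = q - 1 when q ≥ 3, and then s + 1 disjoint k-sets fit into [r].
  spacious : s ≡ 1 ⊎ suc s * k ≤ r
  spacious with q ∸ 1 ≤? 1
  ... | yes q∸1≤1 = inj₁ (m≤n⇒m⊔n≡n q∸1≤1)
  ... | no  q∸1≰1 = inj₂ (subst (λ x → suc x * k ≤ r) (sym (m≥n⇒m⊔n≡m (<⇒≤ (≰⇒> q∸1≰1))))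
                          (subst (λ x → x * k ≤ r) (sym (m+[n∸m]≡n 1≤q)) (m/n*n≤m r k)))
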